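{- Let $\mathcal X = \mathbb F_2^3 = \mathbb F_2\times\mathbb F_2\times\mathbb F_2$ and $Q = \{(x,y,z)\in\mathbb F_2^3 : x+y+z=0\}$. Then for every $n\in\mathbb N$ there exists a $3$-player game $\mathcal G = (\mathcal X,\mathcal A,\mu,Q,V)$ with $\mu$ the uniform distribution on $Q$ such that $\mathrm{val}(\mathcal G^n) = r_{\square}(\mathbb F_2^n)$.
   Context: A $k$-player game is a tuple $\mathcal G = (\mathcal X, \mathcal A, \mu, Q, V)$ where $\mathcal X=\mathcal X^{(1)}\times\dots\times\mathcal X^{(k)}$ and $\mathcal A = \mathcal A^{(1)}\times\dots\times\mathcal A^{(k)}$ are finite product sets (questions/answers of the players), $\mu$ is a distribution on $\mathcal X$ with support $Q$, and $V:\mathcal X\times\mathcal A\to\{0,1\}$. Its value is $\mathrm{val}(\mathcal G) = \max \Pr_{X\sim\mu}[V(X, f^{(1)}(X^{(1)}),\dots,f^{(k)}(X^{(k)}))=1]$ over all functions $f^{(j)}:\mathcal X^{(j)}\to\mathcal A^{(j)}$. The $n$-fold repetition $\mathcal G^n = (\mathcal X^n, \mathcal A^n, \mu^n, Q^n, V^n)$ has player $j$ receive a vector in $(\mathcal X^{(j)})^n$ and answer in $(\mathcal A^{(j)})^n$, distribution $\mu^n(x)=\prod_i\mu(x_i)$, and predicate $V^n(x,a)=\prod_{i=1}^n V(x_i,a_i)$. A square in $\mathbb F_2^n\times\mathbb F_2^n$ is a set $\{(x,y),(x+d,y),(x,y+d),(x+d,y+d)\}$ with $x,y,d\in\mathbb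 F_2^n$, $d\ne0$. $r_{\square}(\mathbb F_2^n)$ is the maximum of $|A|/4^n$ over sets $A\subseteq\mathbb F_2^n\times\mathbb F_2^n$ containing no square. -}

module Defs where

open import Data.Nat using (ℕ; zero; suc)
open import Data.Fin using (Fin; zero; suc)
open import Data.Bool using (Bool; true; false; _∧_; if_then_else_)
open import Data.List using (List; []; _∷_; map; concatMap; foldr; allFin)
open import Data.Vec as Vec using (Vec; []; _∷_)
open import Data.Product using (Σ; _×_; _,_; proj₁; proj₂)
open import Data.Integer using (+_)
open import Data.Rational using (ℚ; 0ℚ; 1ℚ; _+_; _*_; _≤_; _/_)
open import Relation.Binary.PropositionalEquality using (_≡_; _≢_)

vecs : {A : Set} → List A → (n : ℕ) → List (Vec A n)
vecs xs zero    = [] ∷ []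
vecs xs (suc n) = concatMap (λ x → map (x ∷_) (vecs xs n)) xs

sumℚ : List ℚ → ℚ
sumℚ = foldr _+_ 0ℚ

prodℚ : List ℚ → ℚ
prodℚ = foldr _*_ 1ℚ

indicator : Bool → ℚ
indicator b = if b then 1ℚ else 0ℚ

F₂ : Set
F₂ = Fin 2

_⊕_ : F₂ → F₂ → F₂
zero ⊕ y = y
suc zero ⊕ zero = suc zero
suc zero ⊕ suc zero = zero

isZero : F₂ → Bool
isZero zero    = true
isZero (suc _) = false

quarter : ℚ
quarter = + 1 / 4

-- 3-player games with question sets Fin q₁, Fin q₂, Fin q₃ and
-- (finite) answer sets Fin a₁, Fin a₂, Fin a₃.
-- μ is the distribution on the question set; Q is its support.

record Game3 (q₁ q₂ q₃ : ℕ) : Set where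
  field
    a₁ a₂ a₃ : ℕ
    μ : Fin q₁ → Fin q₂ → Fin q₃ → ℚ
    V : Fin q₁ → Fin q₂ → Fin q₃ → Fin a₁ → Fin a₂ → Fin a₃ → Bool

module Repetition {q₁ q₂ q₃ : ℕ} (G : Game3 q₁ q₂ q₃) (n : ℕ) where
  open Game3 G

  Question : Set
  Question = Fin q₁ × Fin q₂ × Fin q₃

  allQuestions : List Question
  allQuestions = concatMap (λ x → concatMap (λ y → map (λ z → x , y , z) (allFin q₃)) (allFin q₂)) (allFin q₁)

  μⁿ : Vec Question n → ℚ
  μⁿ xs = prodℚ (Vec.toList (Vec.map (λ { (x , y , z) → μ x y z }) xs))

  Vⁿ : ∀ {m} → Vec Question m → Vec (Fin a₁) m → Vec (Fin a₂) m → Vec (Fin a₃) m → Bool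
  Vⁿ [] [] [] [] = true
  Vⁿ ((x , y , z) ∷ xs) (a ∷ as) (b ∷ bs) (c ∷ cs) = V x y z a b c ∧ Vⁿ xs as bs cs

  succProb : (Vec (Fin q₁) n → Vec (Fin a₁) n) →
             (Vec (Fin q₂) n → Vec (Fin a₂) n) →
             (Vec (Fin q₃) n → Vec (Fin a₃) n) → ℚ
  succProb f₁ f₂ f₃ = sumℚ (map (λ xs → μⁿ xs * indicator
      (Vⁿ xs (f₁ (Vec.map proj₁ xs))
             (f₂ (Vec.map (λ t → proj₁ (proj₂ t)) xs))
             (f₃ (Vec.map (λ t → proj₂ (proj₂ t)) xs)))) (vecs allQuestions n))

  IsValue : ℚ → Set
  IsValue v =
    Σ (Vec (Fin q₁) n → Vec (Fin a₁) n) (λ f₁ →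
    Σ (Vec (Fin q₂) n → Vec (Fin a₂) n) (λ f₂ →
    Σ (Vec (Fin q₃) n → Vec (Fin a₃) n) (λ f₃ → succProb f₁ f₂ f₃ ≡ v)))
    × (∀ f₁ f₂ f₃ → succProb f₁ f₂ f₃ ≤ v)

ValRepIs : {q₁ q₂ q₃ : ℕ} → Game3 q₁ q₂ q₃ → ℕ → ℚ → Set
ValRepIs G n v = Repetition.IsValue G n v

uniformQ : F₂ → F₂ → F₂ → ℚ
uniformQ x y z = if isZero ((x ⊕ y) ⊕ z) then quarter else 0ℚ

_⊕ᵥ_ : ∀ {n} → Vec F₂ n → Vec F₂ n → Vec F₂ n
_⊕ᵥ_ = Vec.zipWith _⊕_

Subset² : ℕ → Set
Subset² n = Vec F₂ n → Vec F₂ n → Bool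

SquareFree : (n : ℕ) → Subset² n → Set
SquareFree n A = ∀ (x y d : Vec F₂ n) → d ≢ Vec.replicate n zero →
  (A x y ∧ A (x ⊕ᵥ d) y ∧ A x (y ⊕ᵥ d) ∧ A (x ⊕ᵥ d) (y ⊕ᵥ d)) ≡ false

allF₂ : List F₂
allF₂ = allFin 2

density : (n : ℕ) → Subset² n → ℚ
density n A = sumℚ (concatMap (λ x → map (λ y → indicator (A x y)) (vecs allF₂ n)) (vecs allF₂ n))
              * prodℚ (Data.List.replicate n quarter)

RSquareIs : ℕ → ℚ → Set
RSquareIs n r = Σ (Subset² n) (λ A → SquareFree n A × density n A ≡ r)
              × (∀ A → SquareFree n A → density n A ≤ r)

module Submission where

-- Let S be a square-free subset of F₂ⁿ × F₂ⁿ of maximum density.  In the game for S, players 1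
-- and 2 each answer a point of F₂ⁿ and a coordinate, player 3 answers a point, and the verifier
-- accepts iff the two coordinates agree, at that coordinate the two points carry the players'
-- question bits, player 3's point is the sum of the two points, and the pair of points lies in S.
-- Under μⁿ the questions are (x, y, x ⊕ y) with (x, y) uniform, so a strategy wins with
-- probability the density of its winning set W ⊆ F₂ⁿ × F₂ⁿ.  W is square-free: at a coordinate
-- where d is 1, winning answers on x, x ⊕ d, y, y ⊕ d give points p ≢ p′ for player 1 and q, q′
-- for player 2 with p ⊕ q = p′ ⊕ q′, i.e. a square in S.  So val(Gⁿ) ≤ density S, and answering
-- (own question vector, i) in round i wins on all of S.

open import Defs
open import Data.Nat using (ℕ; zero; suc)
open import Data.Fin as Fin using (Fin; zero; suc)
open import Data.Bool as Bool using (Bool; true; false; T; _∧_)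
open import Data.Bool.Properties using (T-∧; T?)
open import Data.List as List
  using (List; []; _∷_; _++_; map; concat; concatMap; length; cartesianProductWith; filter; allFin)
open import Data.List.Properties using (map-++)
open import Data.List.Relation.Unary.Any as Any using (Any; here; there)
open import Data.List.Relation.Unary.Any.Properties using (lookup-index; cartesianProductWith⁺; map⁺)
import Data.List.Relation.Unary.All as All
open import Data.List.Relation.Unary.All.Properties using (all-filter)
open import Data.List.Membership.Propositional using (_∈_; find; lose)
open import Data.List.Membership.Propositional.Properties
  using (∈-map⁺; ∈-concatMap⁺; ∈-cartesianProductWith⁺; ∈-allFin; ∈-filter⁺)
open import Data.Vec as Vec using (Vec; []; _∷_; lookup; replicate; tabulate; zip)
import Data.Vec.Properties as Vecₚ
open import Data.Product using (Σ; ∃; _×_; _,_; proj₁; proj₂)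
open import Data.Sum using (inj₂)
open import Data.Rational using (ℚ; 0ℚ; 1ℚ; _+_; _*_; _≤_; NonNegative)
import Data.Rational.Properties as ℚₚ
open import Data.Empty using (⊥; ⊥-elim)
open import Function using (_∘_; Equivalence)
open import Relation.Binary using (DecTotalOrder)
open import Algebra.Bundles using (CommutativeMonoid)
import Algebra.Properties.CommutativeSemigroup as CommutativeSemigroupProperties
open import Relation.Nullary using (¬_; Dec)
open import Relation.Nullary.Decidable using (map′; ¬?; _×-dec_; _→-dec_; isYes; toWitness; fromWitness)
open import Relation.Binary.PropositionalEquality
  using (_≡_; _≢_; _≗_; refl; sym; trans; cong; cong₂; subst; subst₂; module ≡-Reasoning)

private
  variable
    A B : Set
    m n : ℕ

∑ : List A → (A → ℚ) → ℚ
∑ xs f = sumℚ (map f xs)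

sumℚ-++ : (xs ys : List ℚ) → sumℚ (xs ++ ys) ≡ sumℚ xs + sumℚ ys
sumℚ-++ []       ys = sym (ℚₚ.+-identityˡ _)
sumℚ-++ (x ∷ xs) ys = trans (cong (x +_) (sumℚ-++ xs ys)) (sym (ℚₚ.+-assoc x _ _))

sumℚ-concat : (xss : List (List ℚ)) → sumℚ (concat xss) ≡ ∑ xss sumℚ
sumℚ-concat []         = refl
sumℚ-concat (xs ∷ xss) = trans (sumℚ-++ xs (concat xss)) (cong (sumℚ xs +_) (sumℚ-concat xss))

∑-++ : (xs ys : List A) (f : A → ℚ) → ∑ (xs ++ ys) f ≡ ∑ xs f + ∑ ys f
∑-++ xs ys f = trans (cong sumℚ (map-++ f xs ys)) (sumℚ-++ (map f xs) (map f ys))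

∑-map : (g : A → B) (xs : List A) (f : B → ℚ) → ∑ (map g xs) f ≡ ∑ xs (f ∘ g)
∑-map g []       f = refl
∑-map g (x ∷ xs) f = cong (f (g x) +_) (∑-map g xs f)

∑-concatMap : (g : A → List B) (xs : List A) (f : B → ℚ) →
              ∑ (concatMap g xs) f ≡ ∑ xs (λ a → ∑ (g a) f)
∑-concatMap g []       f = refl
∑-concatMap g (x ∷ xs) f = trans (∑-++ (g x) _ f) (cong (∑ (g x) f +_) (∑-concatMap g xs f))

∑-cong : (xs : List A) {f g : A → ℚ} → f ≗ g → ∑ xs f ≡ ∑ xs g
∑-cong []       f≗g = refl
∑-cong (x ∷ xs) f≗g = cong₂ _+_ (f≗g x) (∑-cong xs f≗g)

∑-mono : (xs : List A) {f g : A → ℚ} → (∀ a → f a ≤ g a) → ∑ xs f ≤ ∑ xs g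
∑-mono []       f≤g = ℚₚ.≤-refl
∑-mono (x ∷ xs) f≤g = ℚₚ.+-mono-≤ (f≤g x) (∑-mono xs f≤g)

∑-zero : (xs : List A) → ∑ xs (λ _ → 0ℚ) ≡ 0ℚ
∑-zero []       = refl
∑-zero (x ∷ xs) = trans (ℚₚ.+-identityˡ _) (∑-zero xs)

∑-*ˡ : (c : ℚ) (xs : List A) (f : A → ℚ) → ∑ xs (λ a → c * f a) ≡ c * ∑ xs f
∑-*ˡ c []       f = sym (ℚₚ.*-zeroʳ c)
∑-*ˡ c (x ∷ xs) f = trans (cong (c * f x +_) (∑-*ˡ c xs f)) (sym (ℚₚ.*-distribˡ-+ c (f x) _))

∑-*ʳ : (c : ℚ) (xs : List A) (f : A → ℚ) → ∑ xs (λ a → f a * c) ≡ ∑ xs f * c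
∑-*ʳ c xs f = begin
  ∑ xs (λ a → f a * c)  ≡⟨ ∑-cong xs (λ a → ℚₚ.*-comm (f a) c) ⟩
  ∑ xs (λ a → c * f a)  ≡⟨ ∑-*ˡ c xs f ⟩
  c * ∑ xs f            ≡⟨ ℚₚ.*-comm c (∑ xs f) ⟩
  ∑ xs f * c            ∎
  where open ≡-Reasoning

∑-+ : (xs : List A) (f g : A → ℚ) → ∑ xs (λ a → f a + g a) ≡ ∑ xs f + ∑ xs g
∑-+ []       f g = sym (ℚₚ.+-identityˡ 0ℚ)
∑-+ (x ∷ xs) f g = trans (cong (f x + g x +_) (∑-+ xs f g)) (interchange (f x) (g x) _ _)
  where open CommutativeSemigroupProperties
          (CommutativeMonoid.commutativeSemigroup ℚₚ.+-0-commutativeMonoid) using (interchange)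

∑-comm : (xs : List A) (ys : List B) (f : A → B → ℚ) →
         ∑ xs (λ a → ∑ ys (f a)) ≡ ∑ ys (λ b → ∑ xs (λ a → f a b))
∑-comm []       ys f = sym (∑-zero ys)
∑-comm (x ∷ xs) ys f =
  trans (cong (∑ ys (f x) +_) (∑-comm xs ys f)) (sym (∑-+ ys (f x) _))

∈-vecs : {xs : List A} → (∀ a → a ∈ xs) → (v : Vec A m) → v ∈ vecs xs m
∈-vecs complete []      = here refl
∈-vecs complete (a ∷ v) =
  ∈-concatMap⁺ _ (Any.map (λ { refl → ∈-map⁺ (a ∷_) (∈-vecs complete v) }) (complete a))

∑-vecs-suc : (xs : List A) (m : ℕ) (h : Vec A (suc m) → ℚ) →
             ∑ (vecs xs (suc m)) h ≡ ∑ xs (λ a → ∑ (vecs xs m) (h ∘ (a ∷_)))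
∑-vecs-suc xs m h = trans (∑-concatMap _ xs h) (∑-cong xs (λ a → ∑-map (a ∷_) (vecs xs m) h))

all?-enumerated : {P : A → Set} {xs : List A} → (∀ a → a ∈ xs) →
                  (∀ a → Dec (P a)) → Dec (∀ a → P a)
all?-enumerated {xs = xs} complete P? =
  map′ (λ all a → All.lookup all (complete a)) (λ all → All.tabulate (λ {a} _ → all a))
       (All.all? P? xs)

encode : {xs : List A} → (∀ a → a ∈ xs) → A → Fin (length xs)
encode complete a = Any.index (complete a)

lookup-encode : {xs : List A} (complete : ∀ a → a ∈ xs) (a : A) →
                List.lookup xs (encode complete a) ≡ a
lookup-encode complete a = sym (lookup-index (complete a))

allBool : List Bool
allBool = true ∷ false ∷ []

∈-allBool : (b : Bool) → b ∈ allBool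
∈-allBool true  = here refl
∈-allBool false = there (here refl)

allF₂ⁿ : (n : ℕ) → List (Vec F₂ n)
allF₂ⁿ = vecs allF₂

∈-allF₂ⁿ : (v : Vec F₂ n) → v ∈ allF₂ⁿ n
∈-allF₂ⁿ = ∈-vecs ∈-allFin

pattern one = suc zero

caseHead : (Vec F₂ m → B) → (Vec F₂ m → B) → Vec F₂ (suc m) → B
caseHead f₀ f₁ (zero ∷ v) = f₀ v
caseHead f₀ f₁ (one  ∷ v) = f₁ v

allFunctions : (m : ℕ) → List B → List (Vec F₂ m → B)
allFunctions zero    bs = map (λ b _ → b) bs
allFunctions (suc m) bs = cartesianProductWith caseHead (allFunctions m bs) (allFunctions m bs)

allFunctions-complete : (R : B → B → Set) {bs : List B} → (∀ b → Any (R b) bs) →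
                        (m : ℕ) (f : Vec F₂ m → B) →
                        Any (λ g → ∀ v → R (f v) (g v)) (allFunctions m bs)
allFunctions-complete R complete zero f =
  map⁺ (Any.map (λ r → λ { [] → r }) (complete (f [])))
allFunctions-complete R complete (suc m) f =
  cartesianProductWith⁺ caseHead (λ r₀ r₁ → λ { (zero ∷ v) → r₀ v ; (one ∷ v) → r₁ v })
    (allFunctions-complete R complete m (f ∘ (zero ∷_)))
    (allFunctions-complete R complete m (f ∘ (one ∷_)))

allSubsets : (n : ℕ) → List (Subset² n)
allSubsets n = allFunctions n (allFunctions n allBool)

allSubsets-complete : (A : Subset² n) → Any (λ B → ∀ x → A x ≗ B x) (allSubsets n)
allSubsets-complete {n} =
  allFunctions-complete _≗_ (allFunctions-complete _≡_ ∈-allBool n) n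

⊕-assoc : ∀ a b c → (a ⊕ b) ⊕ c ≡ a ⊕ (b ⊕ c)
⊕-assoc zero b    c    = refl
⊕-assoc one  zero c    = refl
⊕-assoc one  one  zero = refl
⊕-assoc one  one  one  = refl

⊕-comm : ∀ a b → a ⊕ b ≡ b ⊕ a
⊕-comm zero zero = refl
⊕-comm zero one  = refl
⊕-comm one  zero = refl
⊕-comm one  one  = refl

⊕-identityʳ : ∀ a → a ⊕ zero ≡ a
⊕-identityʳ zero = refl
⊕-identityʳ one  = refl

⊕-self : ∀ a → a ⊕ a ≡ zero
⊕-self zero = refl
⊕-self one  = refl

⊕-one-≢ : ∀ a → a ≢ a ⊕ one
⊕-one-≢ zero ()
⊕-one-≢ one  ()

0ᵥ : Vec F₂ n
0ᵥ = replicate _ zero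

⊕ᵥ-assoc : (x y z : Vec F₂ n) → (x ⊕ᵥ y) ⊕ᵥ z ≡ x ⊕ᵥ (y ⊕ᵥ z)
⊕ᵥ-assoc = Vecₚ.zipWith-assoc ⊕-assoc

⊕ᵥ-comm : (x y : Vec F₂ n) → x ⊕ᵥ y ≡ y ⊕ᵥ x
⊕ᵥ-comm = Vecₚ.zipWith-comm ⊕-comm

⊕ᵥ-identityʳ : (x : Vec F₂ n) → x ⊕ᵥ 0ᵥ ≡ x
⊕ᵥ-identityʳ = Vecₚ.zipWith-identityʳ ⊕-identityʳ

⊕ᵥ-self : (x : Vec F₂ n) → x ⊕ᵥ x ≡ 0ᵥ
⊕ᵥ-self []      = refl
⊕ᵥ-self (a ∷ x) = cong₂ _∷_ (⊕-self a) (⊕ᵥ-self x)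

⊕ᵥ-cancelˡ : (x y : Vec F₂ n) → x ⊕ᵥ (x ⊕ᵥ y) ≡ y
⊕ᵥ-cancelˡ x y = begin
  x ⊕ᵥ (x ⊕ᵥ y)  ≡⟨ sym (⊕ᵥ-assoc x x y) ⟩
  (x ⊕ᵥ x) ⊕ᵥ y  ≡⟨ cong (_⊕ᵥ y) (⊕ᵥ-self x) ⟩
  0ᵥ ⊕ᵥ y        ≡⟨ Vecₚ.zipWith-identityˡ (λ _ → refl) y ⟩
  y              ∎
  where open ≡-Reasoning

⊕ᵥ≡0ᵥ⇒≡ : {x y : Vec F₂ n} → x ⊕ᵥ y ≡ 0ᵥ → x ≡ y
⊕ᵥ≡0ᵥ⇒≡ {x = x} {y} x⊕y≡0 = begin
  x              ≡⟨ sym (⊕ᵥ-identityʳ x) ⟩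
  x ⊕ᵥ 0ᵥ        ≡⟨ cong (x ⊕ᵥ_) (sym x⊕y≡0) ⟩
  x ⊕ᵥ (x ⊕ᵥ y)  ≡⟨ ⊕ᵥ-cancelˡ x y ⟩
  y              ∎
  where open ≡-Reasoning

⊕ᵥ-translate : (x y d : Vec F₂ n) → (x ⊕ᵥ d) ⊕ᵥ (y ⊕ᵥ d) ≡ x ⊕ᵥ y
⊕ᵥ-translate x y d = begin
  (x ⊕ᵥ d) ⊕ᵥ (y ⊕ᵥ d)  ≡⟨ ⊕ᵥ-assoc x d _ ⟩
  x ⊕ᵥ (d ⊕ᵥ (y ⊕ᵥ d))  ≡⟨ cong (λ z → x ⊕ᵥ (d ⊕ᵥ z)) (⊕ᵥ-comm y d) ⟩
  x ⊕ᵥ (d ⊕ᵥ (d ⊕ᵥ y))  ≡⟨ cong (x ⊕ᵥ_) (⊕ᵥ-cancelˡ d y) ⟩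
  x ⊕ᵥ y                ∎
  where open ≡-Reasoning

⊕ᵥ-equalSums⇒shift : (x y x′ y′ : Vec F₂ n) →
                      x ⊕ᵥ y ≡ x′ ⊕ᵥ y′ → y′ ≡ y ⊕ᵥ (x ⊕ᵥ x′)
⊕ᵥ-equalSums⇒shift x y x′ y′ sums≡ = begin
  y′                     ≡⟨ sym (⊕ᵥ-cancelˡ x′ y′) ⟩
  x′ ⊕ᵥ (x′ ⊕ᵥ y′)       ≡⟨ cong (x′ ⊕ᵥ_) (sym sums≡) ⟩
  x′ ⊕ᵥ (x ⊕ᵥ y)         ≡⟨ cong (x′ ⊕ᵥ_) (⊕ᵥ-comm x y) ⟩
  x′ ⊕ᵥ (y ⊕ᵥ x)         ≡⟨ sym (⊕ᵥ-assoc x′ y x) ⟩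
  (x′ ⊕ᵥ y) ⊕ᵥ x         ≡⟨ cong (_⊕ᵥ x) (⊕ᵥ-comm x′ y) ⟩
  (y ⊕ᵥ x′) ⊕ᵥ x         ≡⟨ ⊕ᵥ-assoc y x′ x ⟩
  y ⊕ᵥ (x′ ⊕ᵥ x)         ≡⟨ cong (y ⊕ᵥ_) (⊕ᵥ-comm x′ x) ⟩
  y ⊕ᵥ (x ⊕ᵥ x′)         ∎
  where open ≡-Reasoning

≢0ᵥ⇒one-coordinate : {d : Vec F₂ n} → d ≢ 0ᵥ → ∃ λ i → lookup d i ≡ one
≢0ᵥ⇒one-coordinate {d = []}       d≢0 = ⊥-elim (d≢0 refl)
≢0ᵥ⇒one-coordinate {d = one ∷ d}  d≢0 = zero , refl
≢0ᵥ⇒one-coordinate {d = zero ∷ d} d≢0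
  with ≢0ᵥ⇒one-coordinate (d≢0 ∘ cong (zero ∷_))
... | i , dᵢ≡1 = suc i , dᵢ≡1

lookup-⊕ᵥ-flips : (x d : Vec F₂ n) (i : Fin n) → lookup d i ≡ one → lookup x i ≢ lookup (x ⊕ᵥ d) i
lookup-⊕ᵥ-flips x d i dᵢ≡1 xᵢ≡ = ⊕-one-≢ (lookup x i) (begin
  lookup x i                 ≡⟨ xᵢ≡ ⟩
  lookup (x ⊕ᵥ d) i          ≡⟨ Vecₚ.lookup-zipWith _⊕_ i x d ⟩
  lookup x i ⊕ lookup d i    ≡⟨ cong (lookup x i ⊕_) dᵢ≡1 ⟩
  lookup x i ⊕ one           ∎)
  where open ≡-Reasoning

containsSquare : Subset² n → (x y d : Vec F₂ n) → Bool
containsSquare A x y d = A x y ∧ A (x ⊕ᵥ d) y ∧ A x (y ⊕ᵥ d) ∧ A (x ⊕ᵥ d) (y ⊕ᵥ d)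

T-containsSquare⁻ : {A : Subset² n} {x y d : Vec F₂ n} → T (containsSquare A x y d) →
  T (A x y) × T (A (x ⊕ᵥ d) y) × T (A x (y ⊕ᵥ d)) × T (A (x ⊕ᵥ d) (y ⊕ᵥ d))
T-containsSquare⁻ t =
  let a₁ , t₁ = split t ; a₂ , t₂ = split t₁ ; a₃ , a₄ = split t₂ in a₁ , a₂ , a₃ , a₄
  where
  split : ∀ {a b} → T (a ∧ b) → T a × T b
  split = Equivalence.to T-∧

T-containsSquare⁺ : {A : Subset² n} {x y d : Vec F₂ n} →
  T (A x y) × T (A (x ⊕ᵥ d) y) × T (A x (y ⊕ᵥ d)) × T (A (x ⊕ᵥ d) (y ⊕ᵥ d)) →
  T (containsSquare A x y d)
T-containsSquare⁺ (a₁ , a₂ , a₃ , a₄) = join (a₁ , join (a₂ , join (a₃ , a₄)))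
  where
  join : ∀ {a b} → T a × T b → T (a ∧ b)
  join = Equivalence.from T-∧

squareFree⁺ : {A : Subset² n} →
  (∀ x y d → d ≢ 0ᵥ → ¬ T (containsSquare A x y d)) → SquareFree n A
squareFree⁺ noSquare x y d d≢0 = ¬T⇒≡false (noSquare x y d d≢0)
  where
  ¬T⇒≡false : ∀ {b} → ¬ T b → b ≡ false
  ¬T⇒≡false {false} _   = refl
  ¬T⇒≡false {true}  ¬tt = ⊥-elim (¬tt _)

squareFree⁻ : {A : Subset² n} → SquareFree n A →
  ∀ {x y d} → d ≢ 0ᵥ → ¬ T (containsSquare A x y d)
squareFree⁻ sf {x} {y} {d} d≢0 = subst T (sf x y d d≢0)

squareFree? : (A : Subset² n) → Dec (SquareFree n A)
squareFree? {n} A =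
  all? λ x → all? λ y → all? λ d →
    ¬? (Vecₚ.≡-dec Fin._≟_ d 0ᵥ) →-dec containsSquare A x y d Bool.≟ false
  where
  all? : {P : Vec F₂ n → Set} → (∀ v → Dec (P v)) → Dec (∀ v → P v)
  all? = all?-enumerated ∈-allF₂ⁿ

squareFree-cong : {A B : Subset² n} → (∀ x → A x ≗ B x) → SquareFree n A → SquareFree n B
squareFree-cong {A = A} {B} A≗B sf x y d d≢0 = trans (sym (containsSquare-cong x y d)) (sf x y d d≢0)
  where
  containsSquare-cong : ∀ x y d → containsSquare A x y d ≡ containsSquare B x y d
  containsSquare-cong x y d =
    cong₂ _∧_ (A≗B _ _) (cong₂ _∧_ (A≗B _ _) (cong₂ _∧_ (A≗B _ _) (A≗B _ _)))

squareFree-collision : {A : Subset² n} → SquareFree n A →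
  ∀ {x x′ y y′} → x ≢ x′ → x ⊕ᵥ y ≡ x′ ⊕ᵥ y′ →
  T (A x y) → T (A x′ y) → T (A x y′) → T (A x′ y′) → ⊥
squareFree-collision {n} {A} sf {x} {x′} {y} {y′} x≢x′ sums≡ a₁ a₂ a₃ a₄ =
  squareFree⁻ {A = A} sf {x} {y} {d} (x≢x′ ∘ ⊕ᵥ≡0ᵥ⇒≡)
    (T-containsSquare⁺ {A = A} {x} {y} {d} (a₁ , a₂′ , a₃′ , a₄′))
  where
  d : Vec F₂ n
  d = x ⊕ᵥ x′
  x′≡ : x′ ≡ x ⊕ᵥ d
  x′≡ = sym (⊕ᵥ-cancelˡ x x′)
  y′≡ : y′ ≡ y ⊕ᵥ d
  y′≡ = ⊕ᵥ-equalSums⇒shift x y x′ y′ sums≡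
  a₂′ : T (A (x ⊕ᵥ d) y)
  a₂′ = subst (λ u → T (A u y)) x′≡ a₂
  a₃′ : T (A x (y ⊕ᵥ d))
  a₃′ = subst (λ v → T (A x v)) y′≡ a₃
  a₄′ : T (A (x ⊕ᵥ d) (y ⊕ᵥ d))
  a₄′ = subst₂ (λ u v → T (A u v)) x′≡ y′≡ a₄

quarter^ : ℕ → ℚ
quarter^ m = prodℚ (List.replicate m quarter)

quarter^-nonNeg : ∀ m → NonNegative (quarter^ m)
quarter^-nonNeg zero    = _
quarter^-nonNeg (suc m) = ℚₚ.nonNeg*nonNeg⇒nonNeg quarter (quarter^ m) {{quarter^-nonNeg m}}

sum² : (m : ℕ) → (Vec F₂ m → Vec F₂ m → ℚ) → ℚ
sum² m g = ∑ (allF₂ⁿ m) (λ x → ∑ (allF₂ⁿ m) (g x))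

mean² : (m : ℕ) → (Vec F₂ m → Vec F₂ m → ℚ) → ℚ
mean² m g = sum² m g * quarter^ m

sum²-suc : (m : ℕ) (g : Vec F₂ (suc m) → Vec F₂ (suc m) → ℚ) →
  sum² (suc m) g ≡ ∑ allF₂ (λ a → ∑ allF₂ (λ b → sum² m (λ x y → g (a ∷ x) (b ∷ y))))
sum²-suc m g = begin
  sum² (suc m) g
    ≡⟨ ∑-vecs-suc allF₂ m _ ⟩
  ∑ allF₂ (λ a → ∑ (allF₂ⁿ m) (λ x → ∑ (allF₂ⁿ (suc m)) (g (a ∷ x))))
    ≡⟨ ∑-cong allF₂ (λ a → ∑-cong (allF₂ⁿ m) (λ x → ∑-vecs-suc allF₂ m (g (a ∷ x)))) ⟩
  ∑ allF₂ (λ a → ∑ (allF₂ⁿ m) (λ x → ∑ allF₂ (λ b → ∑ (allF₂ⁿ m) (g (a ∷ x) ∘ (b ∷_)))))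
    ≡⟨ ∑-cong allF₂ (λ a →
         ∑-comm (allF₂ⁿ m) allF₂ (λ x b → ∑ (allF₂ⁿ m) (g (a ∷ x) ∘ (b ∷_)))) ⟩
  ∑ allF₂ (λ a → ∑ allF₂ (λ b → sum² m (λ x y → g (a ∷ x) (b ∷ y))))
    ∎
  where open ≡-Reasoning

mean²-suc : (m : ℕ) (g : Vec F₂ (suc m) → Vec F₂ (suc m) → ℚ) →
  mean² (suc m) g
    ≡ quarter * ∑ allF₂ (λ a → ∑ allF₂ (λ b → mean² m (λ x y → g (a ∷ x) (b ∷ y))))
mean²-suc m g = begin
  sum² (suc m) g * (quarter * quarter^ m)
    ≡⟨ x∙yz≈y∙xz (sum² (suc m) g) quarter (quarter^ m) ⟩
  quarter * (sum² (suc m) g * quarter^ m)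
    ≡⟨ cong (λ s → quarter * (s * quarter^ m)) (sum²-suc m g) ⟩
  quarter * (∑ allF₂ (λ a → ∑ allF₂ (λ b → sum² m (g′ a b))) * quarter^ m)
    ≡⟨ cong (quarter *_) (sym (∑-*ʳ (quarter^ m) allF₂ (λ a → ∑ allF₂ (λ b → sum² m (g′ a b))))) ⟩
  quarter * ∑ allF₂ (λ a → ∑ allF₂ (λ b → sum² m (g′ a b)) * quarter^ m)
    ≡⟨ cong (quarter *_) (∑-cong allF₂ (λ a →
         sym (∑-*ʳ (quarter^ m) allF₂ (λ b → sum² m (g′ a b))))) ⟩
  quarter * ∑ allF₂ (λ a → ∑ allF₂ (λ b → mean² m (g′ a b)))
    ∎
  where
  open ≡-Reasoning
  open CommutativeSemigroupProperties
    (CommutativeMonoid.commutativeSemigroup ℚₚ.*-1-commutativeMonoid) using (x∙yz≈y∙xz)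
  g′ : F₂ → F₂ → Vec F₂ m → Vec F₂ m → ℚ
  g′ a b x y = g (a ∷ x) (b ∷ y)

mean²-cong : {g h : Vec F₂ m → Vec F₂ m → ℚ} → (∀ x → g x ≗ h x) → mean² m g ≡ mean² m h
mean²-cong {m} g≗h = cong (_* quarter^ m) (∑-cong (allF₂ⁿ m) (λ x → ∑-cong (allF₂ⁿ m) (g≗h x)))

mean²-mono : {g h : Vec F₂ m → Vec F₂ m → ℚ} → (∀ x y → g x y ≤ h x y) → mean² m g ≤ mean² m h
mean²-mono {m} g≤h = ℚₚ.*-monoʳ-≤-nonNeg (quarter^ m) {{quarter^-nonNeg m}}
  (∑-mono (allF₂ⁿ m) (λ x → ∑-mono (allF₂ⁿ m) (g≤h x)))

density≡mean² : (A : Subset² n) → density n A ≡ mean² n (λ x y → indicator (A x y))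
density≡mean² {n} A = cong (_* quarter^ n)
  (trans (sumℚ-concat (map row (allF₂ⁿ n))) (∑-map row (allF₂ⁿ n) sumℚ))
  where
  row : Vec F₂ n → List ℚ
  row x = map (λ y → indicator (A x y)) (allF₂ⁿ n)

density-cong : {A B : Subset² n} → (∀ x → A x ≗ B x) → density n A ≡ density n B
density-cong {n} {A} {B} A≗B = begin
  density n A  ≡⟨ density≡mean² A ⟩
  _            ≡⟨ mean²-cong (λ x y → cong indicator (A≗B x y)) ⟩
  _            ≡⟨ sym (density≡mean² B) ⟩
  density n B  ∎
  where open ≡-Reasoning

density-mono : {A B : Subset² n} → (∀ x y → T (A x y) → T (B x y)) → density n A ≤ density n B
density-mono {A = A} {B} A⊆B = subst₂ _≤_ (sym (density≡mean² A)) (sym (density≡mean² B))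
  (mean²-mono (λ x y → indicator-mono (A⊆B x y)))
  where
  indicator-mono : ∀ {a b} → (T a → T b) → indicator a ≤ indicator b
  indicator-mono {false} {false} _   = ℚₚ.≤-refl
  indicator-mono {false} {true}  _   = ℚₚ.nonNegative⁻¹ 1ℚ
  indicator-mono {true}  {true}  _   = ℚₚ.≤-refl
  indicator-mono {true}  {false} a⇒b = ⊥-elim (a⇒b _)

module _ (n : ℕ) where
  open import Data.List.Extrema (DecTotalOrder.totalOrder ℚₚ.≤-decTotalOrder)
    using (argmax; argmax-all; v≤f[argmax]⁺)

  private
    ∅ : Subset² n
    ∅ _ _ = false

    squareFreeSubsets : List (Subset² n)
    squareFreeSubsets = filter squareFree? (allSubsets n)

  maxSquareFree : Subset² n
  maxSquareFree = argmax (density n) ∅ squareFreeSubsets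

  maxSquareFree-squareFree : SquareFree n maxSquareFree
  maxSquareFree-squareFree =
    argmax-all (density n) (λ _ _ _ _ → refl) (all-filter squareFree? (allSubsets n))

  maxSquareFree-maximal : (A : Subset² n) → SquareFree n A → density n A ≤ density n maxSquareFree
  maxSquareFree-maximal A sf with find (allSubsets-complete A)
  ... | B , B∈ , A≗B = v≤f[argmax]⁺ ∅ squareFreeSubsets (inj₂ (lose B∈squareFree A≤B))
    where
    B∈squareFree : B ∈ squareFreeSubsets
    B∈squareFree = ∈-filter⁺ squareFree? B∈ (squareFree-cong A≗B sf)
    A≤B : density n A ≤ density n B
    A≤B = ℚₚ.≤-reflexive (density-cong A≗B)

Triple : Set
Triple = F₂ × F₂ × F₂

-- Definitionally Repetition.allQuestions of any game with question sets Fin 2.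
allTriples : List Triple
allTriples = concatMap (λ a → concatMap (λ b → map (λ c → a , b , c) allF₂) allF₂) allF₂

private
  only-first : ∀ u v → quarter * u + (0ℚ * v + 0ℚ) ≡ quarter * u
  only-first u v =
    trans (cong (quarter * u +_) (trans (ℚₚ.+-identityʳ _) (ℚₚ.*-zeroˡ v))) (ℚₚ.+-identityʳ _)

  only-second : ∀ u v → 0ℚ * u + (quarter * v + 0ℚ) ≡ quarter * v
  only-second u v =
    trans (cong (_+ (quarter * v + 0ℚ)) (ℚₚ.*-zeroˡ u)) (trans (ℚₚ.+-identityˡ _) (ℚₚ.+-identityʳ _))

∑-allTriples : (f : Triple → ℚ) →
  ∑ allTriples f ≡ ∑ allF₂ (λ a → ∑ allF₂ (λ b → ∑ allF₂ (λ c → f (a , b , c))))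
∑-allTriples f =
  trans (∑-concatMap column allF₂ f) (∑-cong allF₂ λ a →
    trans (∑-concatMap (fibre a) allF₂ f) (∑-cong allF₂ λ b →
      ∑-map (λ c → a , b , c) allF₂ f))
  where
  fibre : F₂ → F₂ → List Triple
  fibre a b = map (λ c → a , b , c) allF₂
  column : F₂ → List Triple
  column a = concatMap (fibre a) allF₂

∑-uniformQ-fibre : ∀ a b (h : F₂ → ℚ) →
                   ∑ allF₂ (λ c → uniformQ a b c * h c) ≡ quarter * h (a ⊕ b)
∑-uniformQ-fibre zero zero h = only-first  (h zero) (h one)
∑-uniformQ-fibre zero one  h = only-second (h zero) (h one)
∑-uniformQ-fibre one  zero h = only-second (h zero) (h one)
∑-uniformQ-fibre one  one  h = only-first  (h zero) (h one)

∑-uniformQ : (h : Triple → ℚ) →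
  ∑ allTriples (λ (a , b , c) → uniformQ a b c * h (a , b , c))
    ≡ quarter * ∑ allF₂ (λ a → ∑ allF₂ (λ b → h (a , b , a ⊕ b)))
∑-uniformQ h = begin
  ∑ allTriples (λ (a , b , c) → uniformQ a b c * h (a , b , c))
    ≡⟨ ∑-allTriples (λ (a , b , c) → uniformQ a b c * h (a , b , c)) ⟩
  ∑ allF₂ (λ a → ∑ allF₂ (λ b → ∑ allF₂ (λ c → uniformQ a b c * h (a , b , c))))
    ≡⟨ ∑-cong allF₂ (λ a → ∑-cong allF₂ (λ b → ∑-uniformQ-fibre a b (λ c → h (a , b , c)))) ⟩
  ∑ allF₂ (λ a → ∑ allF₂ (λ b → quarter * h (a , b , a ⊕ b)))
    ≡⟨ ∑-cong allF₂ (λ a → ∑-*ˡ quarter allF₂ (λ b → h (a , b , a ⊕ b))) ⟩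
  ∑ allF₂ (λ a → quarter * ∑ allF₂ (λ b → h (a , b , a ⊕ b)))
    ≡⟨ ∑-*ˡ quarter allF₂ (λ a → ∑ allF₂ (λ b → h (a , b , a ⊕ b))) ⟩
  quarter * ∑ allF₂ (λ a → ∑ allF₂ (λ b → h (a , b , a ⊕ b)))
    ∎
  where open ≡-Reasoning

questions : Vec F₂ m → Vec F₂ m → Vec Triple m
questions x y = zip x (zip y (x ⊕ᵥ y))

map-proj₁-questions : (x y : Vec F₂ m) → Vec.map proj₁ (questions x y) ≡ x
map-proj₁-questions x y = Vecₚ.map-proj₁-zip x _

map-proj₁∘proj₂-questions : (x y : Vec F₂ m) → Vec.map (proj₁ ∘ proj₂) (questions x y) ≡ y
map-proj₁∘proj₂-questions x y = begin
  Vec.map (proj₁ ∘ proj₂) (questions x y)        ≡⟨ Vecₚ.map-∘ proj₁ proj₂ (questions x y) ⟩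
  Vec.map proj₁ (Vec.map proj₂ (questions x y))  ≡⟨ cong (Vec.map proj₁) (Vecₚ.map-proj₂-zip x _) ⟩
  Vec.map proj₁ (zip y (x ⊕ᵥ y))                 ≡⟨ Vecₚ.map-proj₁-zip y _ ⟩
  y                                              ∎
  where open ≡-Reasoning

map-proj₂∘proj₂-questions : (x y : Vec F₂ m) → Vec.map (proj₂ ∘ proj₂) (questions x y) ≡ x ⊕ᵥ y
map-proj₂∘proj₂-questions x y = begin
  Vec.map (proj₂ ∘ proj₂) (questions x y)        ≡⟨ Vecₚ.map-∘ proj₂ proj₂ (questions x y) ⟩
  Vec.map proj₂ (Vec.map proj₂ (questions x y))  ≡⟨ cong (Vec.map proj₂) (Vecₚ.map-proj₂-zip x _) ⟩
  Vec.map proj₂ (zip y (x ⊕ᵥ y))                 ≡⟨ Vecₚ.map-proj₂-zip y _ ⟩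
  x ⊕ᵥ y                                         ∎
  where open ≡-Reasoning

module _ (G : Game3 2 2 2) where
  open Game3 G
  open Repetition G using (Vⁿ)

  winningSet : (Vec F₂ n → Vec (Fin a₁) n) → (Vec F₂ n → Vec (Fin a₂) n) →
               (Vec F₂ n → Vec (Fin a₃) n) → Subset² n
  winningSet {n} f₁ f₂ f₃ x y = Vⁿ n (questions x y) (f₁ x) (f₂ y) (f₃ (x ⊕ᵥ y))

  -- Vⁿ does not depend on the parameter k of Repetition; keeping k fixed lets the recursion go through.
  Vⁿ-questions⁻ : {k : ℕ} (x y : Vec F₂ m)
    (as : Vec (Fin a₁) m) (bs : Vec (Fin a₂) m) (cs : Vec (Fin a₃) m) →
    T (Vⁿ k (questions x y) as bs cs) → ∀ i →
    T (V (lookup x i) (lookup y i) (lookup x i ⊕ lookup y i) (lookup as i) (lookup bs i) (lookup cs i))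
  Vⁿ-questions⁻ (_ ∷ x) (_ ∷ y) (_ ∷ as) (_ ∷ bs) (_ ∷ cs) w zero    = proj₁ (Equivalence.to T-∧ w)
  Vⁿ-questions⁻ (_ ∷ x) (_ ∷ y) (_ ∷ as) (_ ∷ bs) (_ ∷ cs) w (suc i) =
    Vⁿ-questions⁻ x y as bs cs (proj₂ (Equivalence.to T-∧ w)) i

  Vⁿ-questions⁺ : {k : ℕ} (x y : Vec F₂ m)
    (as : Vec (Fin a₁) m) (bs : Vec (Fin a₂) m) (cs : Vec (Fin a₃) m) →
    (∀ i → T (V (lookup x i) (lookup y i) (lookup x i ⊕ lookup y i) (lookup as i) (lookup bs i) (lookup cs i))) →
    T (Vⁿ k (questions x y) as bs cs)
  Vⁿ-questions⁺ []      []      []       []       []       w = _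
  Vⁿ-questions⁺ (_ ∷ x) (_ ∷ y) (_ ∷ as) (_ ∷ bs) (_ ∷ cs) w =
    Equivalence.from T-∧ (w zero , Vⁿ-questions⁺ x y as bs cs (w ∘ suc))

  module _ (uniform : ∀ x y z → μ x y z ≡ uniformQ x y z) where

    ∑-μⁿ≡mean² : ∀ m (F : Vec Triple m → ℚ) →
      ∑ (vecs allTriples m) (λ ts → Repetition.μⁿ G m ts * F ts)
        ≡ mean² m (λ x y → F (questions x y))
    ∑-μⁿ≡mean² zero    F = begin
      1ℚ * F [] + 0ℚ                 ≡⟨ ℚₚ.+-identityʳ _ ⟩
      1ℚ * F []                      ≡⟨ ℚₚ.*-identityˡ _ ⟩
      F []                           ≡⟨ sym (ℚₚ.+-identityʳ _) ⟩
      F [] + 0ℚ                      ≡⟨ sym (ℚₚ.+-identityʳ _) ⟩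
      (F [] + 0ℚ) + 0ℚ               ≡⟨ sym (ℚₚ.*-identityʳ _) ⟩
      ((F [] + 0ℚ) + 0ℚ) * 1ℚ        ∎
      where open ≡-Reasoning
    ∑-μⁿ≡mean² (suc m) F = begin
      ∑ (vecs allTriples (suc m)) (λ ts → μⁿ (suc m) ts * F ts)
        ≡⟨ ∑-vecs-suc allTriples m (λ ts → μⁿ (suc m) ts * F ts) ⟩
      ∑ allTriples (λ t → ∑ (vecs allTriples m) (λ ts → μ₁ t * μⁿ m ts * F (t ∷ ts)))
        ≡⟨ ∑-cong allTriples factor-μ₁ ⟩
      ∑ allTriples (λ t → μ₁ t * ∑ (vecs allTriples m) (λ ts → μⁿ m ts * F (t ∷ ts)))
        ≡⟨ ∑-cong allTriples (λ (a , b , c) →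
             cong₂ _*_ (uniform a b c) (∑-μⁿ≡mean² m (F ∘ ((a , b , c) ∷_)))) ⟩
      ∑ allTriples (λ (a , b , c) → uniformQ a b c * mean² m (λ x y → F ((a , b , c) ∷ questions x y)))
        ≡⟨ ∑-uniformQ (λ t → mean² m (λ x y → F (t ∷ questions x y))) ⟩
      quarter * ∑ allF₂ (λ a → ∑ allF₂ (λ b → mean² m (λ x y → F (questions (a ∷ x) (b ∷ y)))))
        ≡⟨ sym (mean²-suc m (λ x y → F (questions x y))) ⟩
      mean² (suc m) (λ x y → F (questions x y))
        ∎
      where
      open ≡-Reasoning
      μⁿ : ∀ k → Vec Triple k → ℚ
      μⁿ k = Repetition.μⁿ G k
      μ₁ : Triple → ℚ
      μ₁ (a , b , c) = μ a b c
      factor-μ₁ : ∀ t → ∑ (vecs allTriples m) (λ ts → μ₁ t * μⁿ m ts * F (t ∷ ts))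
                      ≡ μ₁ t * ∑ (vecs allTriples m) (λ ts → μⁿ m ts * F (t ∷ ts))
      factor-μ₁ t =
        trans (∑-cong (vecs allTriples m) (λ ts → ℚₚ.*-assoc (μ₁ t) (μⁿ m ts) (F (t ∷ ts))))
              (∑-*ˡ (μ₁ t) (vecs allTriples m) (λ ts → μⁿ m ts * F (t ∷ ts)))

    succProb≡density : (f₁ : Vec F₂ n → Vec (Fin a₁) n) (f₂ : Vec F₂ n → Vec (Fin a₂) n)
      (f₃ : Vec F₂ n → Vec (Fin a₃) n) →
      Repetition.succProb G n f₁ f₂ f₃ ≡ density n (winningSet f₁ f₂ f₃)
    succProb≡density {n} f₁ f₂ f₃ = begin
      Repetition.succProb G n f₁ f₂ f₃
        ≡⟨ ∑-μⁿ≡mean² n play ⟩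
      mean² n (λ x y → play (questions x y))
        ≡⟨ mean²-cong play-questions ⟩
      mean² n (λ x y → indicator (winningSet f₁ f₂ f₃ x y))
        ≡⟨ sym (density≡mean² (winningSet f₁ f₂ f₃)) ⟩
      density n (winningSet f₁ f₂ f₃)
        ∎
      where
      open ≡-Reasoning
      play : Vec Triple n → ℚ
      play ts = indicator (Vⁿ n ts (f₁ (Vec.map proj₁ ts)) (f₂ (Vec.map (proj₁ ∘ proj₂) ts))
                                   (f₃ (Vec.map (proj₂ ∘ proj₂) ts)))
      play-questions : ∀ x y → play (questions x y) ≡ indicator (winningSet f₁ f₂ f₃ x y)
      play-questions x y
        rewrite map-proj₁-questions x y
              | map-proj₁∘proj₂-questions x y
              | map-proj₂∘proj₂-questions x y = refl

record Claim (n : ℕ) : Set where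
  constructor claim
  field
    point : Vec F₂ n
    coord : Fin n
open Claim

allClaims : (n : ℕ) → List (Claim n)
allClaims n = cartesianProductWith claim (allF₂ⁿ n) (allFin n)

∈-allClaims : (c : Claim n) → c ∈ allClaims n
∈-allClaims (claim x i) = ∈-cartesianProductWith⁺ claim (∈-allF₂ⁿ x) (∈-allFin i)

module SquareGame {n : ℕ} (A : Subset² n) where

  Accepts : F₂ → F₂ → Claim n → Claim n → Vec F₂ n → Set
  Accepts a b p q z =
    coord p ≡ coord q × lookup (point p) (coord p) ≡ a × lookup (point q) (coord q) ≡ b ×
    z ≡ point p ⊕ᵥ point q × T (A (point p) (point q))

  accepts? : ∀ a b p q z → Dec (Accepts a b p q z)
  accepts? a b p q z =
    coord p Fin.≟ coord q ×-dec
    lookup (point p) (coord p) Fin.≟ a ×-dec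
    lookup (point q) (coord q) Fin.≟ b ×-dec
    Vecₚ.≡-dec Fin._≟_ z (point p ⊕ᵥ point q) ×-dec
    T? (A (point p) (point q))

  decodeClaim : Fin (length (allClaims n)) → Claim n
  decodeClaim = List.lookup (allClaims n)

  decodePoint : Fin (length (allF₂ⁿ n)) → Vec F₂ n
  decodePoint = List.lookup (allF₂ⁿ n)

  -- The third question is ignored: on the support of uniformQ it is x ⊕ y.
  game : Game3 2 2 2
  game = record
    { a₁ = length (allClaims n)
    ; a₂ = length (allClaims n)
    ; a₃ = length (allF₂ⁿ n)
    ; μ  = uniformQ
    ; V  = λ x y _ a b c → isYes (accepts? x y (decodeClaim a) (decodeClaim b) (decodePoint c))
    }

  open Game3 game using (a₁; a₂; a₃)
  open Repetition game n using (succProb)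

  no-accepting-square : SquareFree n A →
    ∀ {a a′ a″ a‴ b b′ b″ b‴ p p′ q q′ z z′ z″} → a ≢ a′ →
    Accepts a b p q z → Accepts a′ b′ p′ q z′ →
    Accepts a″ b″ p q′ z″ → Accepts a‴ b‴ p′ q′ z → ⊥
  no-accepting-square sf {a} {a′} {p = p} {p′} a≢a′
    (j≡k , pⱼ≡a , _ , z≡ , A₁) (j′≡k , p′ⱼ′≡a′ , _ , _ , A₂)
    (_ , _ , _ , _ , A₃)       (_ , _ , _ , z≡′ , A₄) =
    squareFree-collision {A = A} sf p≢p′ (trans (sym z≡) z≡′) A₁ A₂ A₃ A₄
    where
    open ≡-Reasoning
    p≢p′ : point p ≢ point p′
    p≢p′ p≡p′ = a≢a′ (begin
      a                             ≡⟨ sym pⱼ≡a ⟩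
      lookup (point p) (coord p)    ≡⟨ cong₂ lookup p≡p′ (trans j≡k (sym j′≡k)) ⟩
      lookup (point p′) (coord p′)  ≡⟨ p′ⱼ′≡a′ ⟩
      a′                            ∎)

  winningSet-squareFree : SquareFree n A → (f₁ : Vec F₂ n → Vec (Fin a₁) n)
    (f₂ : Vec F₂ n → Vec (Fin a₂) n) (f₃ : Vec F₂ n → Vec (Fin a₃) n) →
    SquareFree n (winningSet game f₁ f₂ f₃)
  winningSet-squareFree sf f₁ f₂ f₃ = squareFree⁺ {A = W} noSquare
    where
    W : Subset² n
    W = winningSet game f₁ f₂ f₃
    round : ∀ x y → T (W x y) → ∀ i →
      Accepts (lookup x i) (lookup y i) (decodeClaim (lookup (f₁ x) i)) (decodeClaim (lookup (f₂ y) i))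
              (decodePoint (lookup (f₃ (x ⊕ᵥ y)) i))
    round x y w i = toWitness (Vⁿ-questions⁻ game x y (f₁ x) (f₂ y) (f₃ (x ⊕ᵥ y)) w i)
    noSquare : ∀ x y d → d ≢ 0ᵥ → ¬ T (containsSquare W x y d)
    noSquare x y d d≢0 wins
      with T-containsSquare⁻ {A = W} {x} {y} {d} wins | ≢0ᵥ⇒one-coordinate d≢0
    ... | w₁ , w₂ , w₃ , w₄ | i , dᵢ≡1 =
      no-accepting-square sf (lookup-⊕ᵥ-flips x d i dᵢ≡1)
        (round x y w₁ i) (round (x ⊕ᵥ d) y w₂ i) (round x (y ⊕ᵥ d) w₃ i)
        (subst (λ v → Accepts _ _ _ _ (decodePoint (lookup (f₃ v) i)))
               (⊕ᵥ-translate x y d) (round (x ⊕ᵥ d) (y ⊕ᵥ d) w₄ i))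

  honest₁₂ : Vec F₂ n → Vec (Fin a₁) n
  honest₁₂ x = tabulate (λ i → encode ∈-allClaims (claim x i))

  honest₃ : Vec F₂ n → Vec (Fin a₃) n
  honest₃ z = replicate n (encode ∈-allF₂ⁿ z)

  honest-wins : ∀ x y → T (A x y) → T (winningSet game honest₁₂ honest₁₂ honest₃ x y)
  honest-wins x y axy = Vⁿ-questions⁺ game x y _ _ _ (λ i → fromWitness (accepted i))
    where
    claim-honest : ∀ v i → decodeClaim (lookup (honest₁₂ v) i) ≡ claim v i
    claim-honest v i = trans (cong decodeClaim (Vecₚ.lookup∘tabulate _ i)) (lookup-encode ∈-allClaims _)
    point-honest : ∀ v i → decodePoint (lookup (honest₃ v) i) ≡ v
    point-honest v i = trans (cong decodePoint (Vecₚ.lookup-replicate i _)) (lookup-encode ∈-allF₂ⁿ v)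
    accepted : ∀ i → Accepts (lookup x i) (lookup y i) (decodeClaim (lookup (honest₁₂ x) i))
      (decodeClaim (lookup (honest₁₂ y) i)) (decodePoint (lookup (honest₃ (x ⊕ᵥ y)) i))
    accepted i rewrite claim-honest x i | claim-honest y i | point-honest (x ⊕ᵥ y) i =
      refl , refl , refl , refl , axy

  value : SquareFree n A → (∀ B → SquareFree n B → density n B ≤ density n A) →
          ValRepIs game n (density n A)
  value sf maximal =
    (honest₁₂ , honest₁₂ , honest₃ , ℚₚ.≤-antisym (upper honest₁₂ honest₁₂ honest₃) lower) , upper
    where
    succProb≡ : ∀ f₁ f₂ f₃ → succProb f₁ f₂ f₃ ≡ density n (winningSet game f₁ f₂ f₃)
    succProb≡ = succProb≡density game (λ _ _ _ → refl)
    upper : ∀ f₁ f₂ f₃ → succProb f₁ f₂ f₃ ≤ density n A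
    upper f₁ f₂ f₃ = subst (_≤ density n A) (sym (succProb≡ f₁ f₂ f₃))
                           (maximal _ (winningSet-squareFree sf f₁ f₂ f₃))
    lower : density n A ≤ succProb honest₁₂ honest₁₂ honest₃
    lower = subst (density n A ≤_) (sym (succProb≡ honest₁₂ honest₁₂ honest₃))
                  (density-mono honest-wins)

corollary4p8 : (n : ℕ) → Σ (Game3 2 2 2) (λ G →
    (∀ x y z → Game3.μ G x y z ≡ uniformQ x y z) ×
    Σ ℚ (λ v → ValRepIs G n v × RSquareIs n v))
corollary4p8 n =
  SquareGame.game S , (λ _ _ _ → refl) , density n S ,
  SquareGame.value S sf maximal , (S , sf , refl) , maximal
  where
  S : Subset² n
  S = maxSquareFree n
  sf : SquareFree n S
  sf = maxSquareFree-squareFree n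
  maximal : ∀ B → SquareFree n B → density n B ≤ density n S
  maximal = maxSquareFree-maximal n
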